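{- Let $G$ be an abelian group with a direct sum decomposition $G=\mathbb Z\oplus H$, where $\mathbb Z$ denotes an infinite cyclic subgroup and $H<G$ is finite. Let $B,C$ be finite nonempty subsets of $G$, and let $m$ and $n$ be the sizes of the images of $B$ and $C$, respectively, under the projection $G\to\mathbb Z$ along $H$. Then $$|B+C|\ge\Big(1+\frac{n-1}{m}\Big)|B|.$$
   Context: $B+C=\{b+c\colon b\in B,\ c\in C\}$. -}

module Defs where

open import Level using (Level; _⊔_)
open import Algebra.Bundles using (AbelianGroup)
open import Data.Integer using (ℤ) renaming (_+_ to _+ℤ_)
open import Data.Product using (Σ; _×_; _,_; proj₁; proj₂)
open import Data.List using (List)
open import Data.List.Relation.Unary.Any using (Any)
open import Data.List.Relation.Unary.AllPairs using (AllPairs)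
open import Data.List.Membership.Propositional using (_∈_)
open import Relation.Binary.PropositionalEquality using (_≡_)
open import Relation.Nullary using (¬_)

module _ {c ℓ : Level} (H : AbelianGroup c ℓ) where
  private
    module H = AbelianGroup H

  G : Set c
  G = ℤ × H.Carrier

  _≈G_ : G → G → Set ℓ
  (a , x) ≈G (b , y) = (a ≡ b) × (x H.≈ y)

  _+G_ : G → G → G
  (a , x) +G (b , y) = (a +ℤ b , x H.∙ y)

  projℤ : G → ℤ
  projℤ = proj₁

  FiniteGroup : Set (c ⊔ ℓ)
  FiniteGroup = Σ (List H.Carrier) λ L → ∀ (x : H.Carrier) → Any (x H.≈_) L

  _∈G_ : G → List G → Set (c ⊔ ℓ)
  g ∈G L = Any (g ≈G_) L

  -- a list with no two equal entries (so it represents a finite set of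
  -- exactly `length` elements)
  DistinctG : List G → Set (c ⊔ ℓ)
  DistinctG = AllPairs (λ g h → ¬ (g ≈G h))

  SumSet : List G → List G → G → Set (c ⊔ ℓ)
  SumSet B C g = Σ G λ b → Σ G λ d → (b ∈G B) × (d ∈G C) × (g ≈G (b +G d))

  InImage : List G → ℤ → Set (c ⊔ ℓ)
  InImage B k = Σ G λ b → (b ∈G B) × (projℤ b ≡ k)

  EnumeratesG : List G → (G → Set (c ⊔ ℓ)) → Set (c ⊔ ℓ)
  EnumeratesG L P = ∀ (g : G) → ((g ∈G L → P g) × (P g → g ∈G L))

  EnumeratesImage : List ℤ → List G → Set (c ⊔ ℓ)
  EnumeratesImage M B = ∀ (k : ℤ) → ((k ∈ M → InImage B k) × (InImage B k → k ∈ M))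

-- Fix a level a of the ℤ-coordinate and let lo, hi be elements of C of least and
-- greatest level.  The sets (B_{<a} + lo), (B_a + C') and (B_{>a} + hi), where
-- C' picks one element of C over each of the n levels of C, lie in B + C and
-- are pairwise disjoint, since they sit below, within and above the level
-- band [a + lo, a + hi].  Hence |B + C| ≥ |B| + (n - 1)|B_a|, and summing over
-- the m levels a of B gives m|B + C| ≥ m|B| + (n - 1)|B|.
module Submission where

open import Defs
open import Level using (Level)
open import Algebra.Bundles using (AbelianGroup)
open import Data.Nat using (ℕ; _+_; _*_; _∸_; _≤_)
open import Data.Integer using (ℤ)
open import Data.List using (List; []; length)
open import Data.List.Relation.Unary.Unique.Propositional using (Unique)
open import Relation.Binary.PropositionalEquality using (_≢_)

open import Data.Nat using (suc; z≤n; s≤s)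
open import Data.Nat.Properties
  using (≤-reflexive; +-mono-≤; +-monoʳ-≤; *-monoʳ-≤; *-zeroʳ; +-suc; *-distribʳ-+; module ≤-Reasoning)
open import Data.Nat.Tactic.RingSolver using (solve-∀)
import Data.Integer as ℤ
import Data.Integer.Properties as ℤ
open import Data.List using (_∷_; _++_; map; concatMap; filter; removeAt)
open import Data.List.Properties using (length-++; length-map; length-removeAt′; filter-accept; filter-reject)
open import Data.List.Relation.Unary.Any as Any using (Any; here; there; index)
import Data.List.Relation.Unary.Any.Properties as Anyₚ
open import Data.List.Relation.Unary.All as All using (All; []; _∷_)
import Data.List.Relation.Unary.All.Properties as Allₚ
open import Data.List.Relation.Unary.AllPairs using (AllPairs; []; _∷_)
import Data.List.Relation.Unary.AllPairs.Properties as AllPairs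
import Data.List.Relation.Unary.Unique.Setoid as UniqueSetoid
import Data.List.Relation.Unary.Unique.Setoid.Properties as UniqueSetoidₚ
import Data.List.Membership.Setoid as SetoidMembership
open import Data.List.Membership.Setoid.Properties using (∈-resp-≈; All[≉]⇒∉; ∈-filter⁺)
open import Data.List.Relation.Binary.Disjoint.Setoid using (Disjoint)
import Data.List.Extrema
open import Data.Product using (Σ; _×_; _,_; proj₁; proj₂)
open import Function using (_∘_; _on_)
open import Relation.Nullary using (¬_; contradiction)
open import Relation.Unary using (Pred; Decidable)
open import Relation.Binary.Bundles using (Setoid)
open import Relation.Binary.Definitions using (tri<; tri≈; tri>)
open import Relation.Binary.PropositionalEquality as ≡ using (_≡_; refl; cong; subst)
import Algebra.Construct.DirectProduct as DirectProduct
import Algebra.Properties.Group as GroupProperties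

module _ {a ℓ} (S : Setoid a ℓ) where
  open Setoid S
  open SetoidMembership S using () renaming (_∈_ to _∈ₛ_)
  open UniqueSetoid S using () renaming (Unique to Uniqueₛ)

  All-∈-self : ∀ xs → All (_∈ₛ xs) xs
  All-∈-self xs = All.tabulate (Any.map reflexive)

  private
    ∈-removeAt : ∀ {x y ys} (x∈ys : x ∈ₛ ys) → y ∈ₛ ys → ¬ y ≈ x → y ∈ₛ removeAt ys (index x∈ys)
    ∈-removeAt (here x≈z) (here y≈z)   y≉x = contradiction (trans y≈z (sym x≈z)) y≉x
    ∈-removeAt (here _)   (there y∈zs) _   = y∈zs
    ∈-removeAt (there _)  (here y≈z)   _   = here y≈z
    ∈-removeAt (there x∈zs) (there y∈zs) y≉x = there (∈-removeAt x∈zs y∈zs y≉x)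

  Unique∧⊆⇒length≤ : ∀ {xs ys} → Uniqueₛ xs → All (_∈ₛ ys) xs → length xs ≤ length ys
  Unique∧⊆⇒length≤ {[]}     _            _               = z≤n
  Unique∧⊆⇒length≤ {x ∷ xs} {ys} (x≉xs ∷ xs!) (x∈ys ∷ xs⊆ys) = begin
    suc (length xs)                        ≤⟨ s≤s (Unique∧⊆⇒length≤ xs! xs⊆ys-x) ⟩
    suc (length (removeAt ys (index x∈ys))) ≡⟨ length-removeAt′ ys (index x∈ys) ⟨
    length ys                              ∎
    where
    open ≤-Reasoning
    xs⊆ys-x : All (_∈ₛ removeAt ys (index x∈ys)) xs
    xs⊆ys-x = All.tabulate λ {y} y∈xs → ∈-removeAt x∈ys (All.lookup xs⊆ys y∈xs)
      λ y≈x → All[≉]⇒∉ S x≉xs (∈-resp-≈ S y≈x (Any.map reflexive y∈xs))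

concatMap-length-bound : ∀ {a b} {A : Set a} {X : Set b} {x s : ℕ} k (F : A → List X) →
  (∀ t → x + k * length (F t) ≤ s) →
  ∀ M → length M * x + k * length (concatMap F M) ≤ length M * s
concatMap-length-bound k F bound [] = ≤-reflexive (*-zeroʳ k)
concatMap-length-bound {x = x} {s} k F bound (t ∷ M) = begin
  (x + length M * x) + k * length (F t ++ concatMap F M)
    ≡⟨ cong (λ l → (x + length M * x) + k * l) (length-++ (F t)) ⟩
  (x + length M * x) + k * (length (F t) + length (concatMap F M))
    ≡⟨ regroup x (length M * x) k (length (F t)) (length (concatMap F M)) ⟩
  (x + k * length (F t)) + (length M * x + k * length (concatMap F M))
    ≤⟨ +-mono-≤ (bound t) (concatMap-length-bound k F bound M) ⟩
  s + length M * s ∎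
  where
  open ≤-Reasoning
  regroup : ∀ x y k f r → x + y + k * (f + r) ≡ (x + k * f) + (y + k * r)
  regroup = solve-∀

module _ {a} {A : Set a} (f : A → ℤ) (t : ℤ) where
  below fibre above : List A → List A
  below = filter (λ x → f x ℤ.<? t)
  fibre = filter (λ x → f x ℤ.≟ t)
  above = filter (λ x → t ℤ.<? f x)

  length-below+fibre+above : ∀ xs → length (below xs) + length (fibre xs) + length (above xs) ≡ length xs
  length-below+fibre+above [] = refl
  length-below+fibre+above (x ∷ xs) with ℤ.<-cmp (f x) t
  ... | tri< fx<t fx≢t fx≯t
    rewrite filter-accept (λ x → f x ℤ.<? t) {x} {xs} fx<t
          | filter-reject (λ x → f x ℤ.≟ t) {x} {xs} fx≢t
          | filter-reject (λ x → t ℤ.<? f x) {x} {xs} fx≯t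
    = cong suc (length-below+fibre+above xs)
  ... | tri≈ fx≮t fx≡t fx≯t
    rewrite filter-reject (λ x → f x ℤ.<? t) {x} {xs} fx≮t
          | filter-accept (λ x → f x ℤ.≟ t) {x} {xs} fx≡t
          | filter-reject (λ x → t ℤ.<? f x) {x} {xs} fx≯t
    = ≡.trans (cong (_+ length (above xs)) (+-suc (length (below xs)) (length (fibre xs))))
              (cong suc (length-below+fibre+above xs))
  ... | tri> fx≮t fx≢t fx>t
    rewrite filter-reject (λ x → f x ℤ.<? t) {x} {xs} fx≮t
          | filter-reject (λ x → f x ℤ.≟ t) {x} {xs} fx≢t
          | filter-accept (λ x → t ℤ.<? f x) {x} {xs} fx>t
    = ≡.trans (+-suc (length (below xs) + length (fibre xs)) (length (above xs)))
              (cong suc (length-below+fibre+above xs))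

module _ {c ℓ : Level} (H : AbelianGroup c ℓ) where

  ℤ⊕H : AbelianGroup c ℓ
  ℤ⊕H = DirectProduct.abelianGroup ℤ.+-0-abelianGroup H

  private
    Gₛ = AbelianGroup.setoid ℤ⊕H
    module Gₛ = Setoid Gₛ
    _∙_ = _+G_ H
    π = projℤ H

  open SetoidMembership Gₛ using () renaming (_∈_ to _∈ᴳ_)
  open UniqueSetoid Gₛ using () renaming (Unique to Uniqueᴳ)

  translate : List (G H) → G H → List (G H)
  translate X d = map (_∙ d) X

  sumsetList : List (G H) → List (G H) → List (G H)
  sumsetList X D = concatMap (translate X) D

  length-sumsetList : ∀ X D → length (sumsetList X D) ≡ length D * length X
  length-sumsetList X []      = refl
  length-sumsetList X (d ∷ D) = ≡.trans (length-++ (translate X d))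
    (≡.cong₂ _+_ (length-map (_∙ d) X) (length-sumsetList X D))

  All-translate : ∀ {p q} {P : Pred (G H) p} {Q : Pred (G H) q} {X d} →
    (∀ {b} → P b → Q (b ∙ d)) → All P X → All Q (translate X d)
  All-translate P⇒Q = Allₚ.map⁺ ∘ All.map P⇒Q

  All-sumsetList : ∀ {p q r} {P : Pred (G H) p} {Q : Pred (G H) q} {R : Pred (G H) r} {X D} →
    (∀ {b d} → P b → Q d → R (b ∙ d)) → All P X → All Q D → All R (sumsetList X D)
  All-sumsetList P⇒Q⇒R PX []         = []
  All-sumsetList P⇒Q⇒R PX (Qd ∷ QD) =
    Allₚ.++⁺ (All-translate (λ Pb → P⇒Q⇒R Pb Qd) PX) (All-sumsetList P⇒Q⇒R PX QD)

  level-∈ : ∀ {p} {P : Pred ℤ p} {X g} → All (P ∘ π) X → g ∈ᴳ X → P (π g)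
  level-∈ {P = P} (Px ∷ _)  (here g≈x)  = subst P (≡.sym (proj₁ g≈x)) Px
  level-∈         (_ ∷ PX) (there g∈X) = level-∈ PX g∈X

  Disjoint-by-level : ∀ {p q} {P : Pred ℤ p} {Q : Pred ℤ q} {X Y} →
    (∀ {i} → P i → ¬ Q i) → All (P ∘ π) X → All (Q ∘ π) Y → Disjoint Gₛ X Y
  Disjoint-by-level P⇒¬Q PX QY (v∈X , v∈Y) = P⇒¬Q (level-∈ PX v∈X) (level-∈ QY v∈Y)

  Unique-translate : ∀ {X} d → Uniqueᴳ X → Uniqueᴳ (translate X d)
  Unique-translate d = UniqueSetoidₚ.map⁺ Gₛ Gₛ (λ {b} {b'} → ∙-cancelʳ d b b')
    where open GroupProperties (AbelianGroup.group ℤ⊕H) using (∙-cancelʳ)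

  -- The translates of X by elements of D of different levels lie on different levels.
  Unique-sumsetList : ∀ {X a} → Uniqueᴳ X → All ((_≡ a) ∘ π) X →
    ∀ {D} → AllPairs (_≢_ on π) D → Uniqueᴳ (sumsetList X D)
  Unique-sumsetList X! X≡a []            = []
  Unique-sumsetList {a = a} X! X≡a {d ∷ D} (d≢D ∷ D!) = UniqueSetoidₚ.++⁺ Gₛ
    (Unique-translate d X!) (Unique-sumsetList X! X≡a D!)
    (Disjoint-by-level {P = _≡ a ℤ.+ π d} {Q = _≢ a ℤ.+ π d} (λ i≡ i≢ → i≢ i≡)
      (All-translate (cong (ℤ._+ π d)) X≡a)
      (All-sumsetList {Q = (π d ≢_) ∘ π} (λ πb≡a πd≢πd' → πd≢πd' ∘ cancel πb≡a) X≡a d≢D))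
    where
    open GroupProperties (AbelianGroup.group ℤ.+-0-abelianGroup) using (∙-cancelˡ)
    cancel : ∀ {i j} → i ≡ a → i ℤ.+ j ≡ a ℤ.+ π d → π d ≡ j
    cancel refl eq = ≡.sym (∙-cancelˡ a _ _ eq)

  spreadAt : ℤ → G H → G H → List (G H) → List (G H) → List (G H)
  spreadAt a lo hi D B =
    translate (below π a B) lo ++ (sumsetList (fibre π a B) D ++ translate (above π a B) hi)

  length-spreadAt : ∀ a lo hi d D B →
    length (spreadAt a lo hi (d ∷ D) B) ≡ length B + length D * length (fibre π a B)
  length-spreadAt a lo hi d D B = begin
    length (spreadAt a lo hi (d ∷ D) B)
      ≡⟨ length-++ (translate (below π a B) lo) ⟩
    length (translate (below π a B) lo) + length (sumsetList (fibre π a B) (d ∷ D) ++ translate (above π a B) hi)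
      ≡⟨ ≡.cong₂ _+_ (length-map (_∙ lo) (below π a B))
          (≡.trans (length-++ (sumsetList (fibre π a B) (d ∷ D)))
                   (≡.cong₂ _+_ (length-sumsetList (fibre π a B) (d ∷ D)) (length-map (_∙ hi) (above π a B)))) ⟩
    x + (suc k * y + z)
      ≡⟨ regroup x y z k ⟩
    (x + y + z) + k * y
      ≡⟨ cong (_+ k * y) (length-below+fibre+above π a B) ⟩
    length B + k * y ∎
    where
    open ≡.≡-Reasoning
    x = length (below π a B)
    y = length (fibre π a B)
    z = length (above π a B)
    k = length D
    regroup : ∀ x y z k → x + ((1 + k) * y + z) ≡ (x + y + z) + k * y
    regroup = solve-∀

  Unique-spreadAt : ∀ {a lo hi D B} → Uniqueᴳ B → π lo ℤ.≤ π hi →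
    All ((λ i → π lo ℤ.≤ i × i ℤ.≤ π hi) ∘ π) D → AllPairs (_≢_ on π) D →
    Uniqueᴳ (spreadAt a lo hi D B)
  Unique-spreadAt {a} {lo} {hi} {D} {B} B! lo≤hi lo≤D≤hi D! =
    UniqueSetoidₚ.++⁺ Gₛ (Unique-translate lo (B-part! _))
      (UniqueSetoidₚ.++⁺ Gₛ (Unique-sumsetList (B-part! _) fibre-levels D!) (Unique-translate hi (B-part! _))
        (Disjoint-by-level (λ i≤ <i → ℤ.≤⇒≯ i≤ <i) (All.map proj₂ middle-levels) top-levels))
      (Disjoint-by-level (λ i< ≤i → ℤ.<⇒≱ i< ≤i) bottom-levels
        (Allₚ.++⁺ (All.map proj₁ middle-levels)
                 (All.map (λ <i → ℤ.<⇒≤ (ℤ.≤-<-trans (ℤ.+-monoʳ-≤ a lo≤hi) <i)) top-levels)))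
    where
    B-part! : ∀ {P : Pred (G H) _} (P? : Decidable P) → Uniqueᴳ (filter P? B)
    B-part! P? = UniqueSetoidₚ.filter⁺ Gₛ P? B!
    fibre-levels : All ((_≡ a) ∘ π) (fibre π a B)
    fibre-levels = Allₚ.all-filter (λ x → π x ℤ.≟ a) B
    bottom-levels : All ((ℤ._< a ℤ.+ π lo) ∘ π) (translate (below π a B) lo)
    bottom-levels = All-translate (ℤ.+-monoˡ-< (π lo)) (Allₚ.all-filter (λ x → π x ℤ.<? a) B)
    middle-levels : All ((λ i → a ℤ.+ π lo ℤ.≤ i × i ℤ.≤ a ℤ.+ π hi) ∘ π) (sumsetList (fibre π a B) D)
    middle-levels = All-sumsetList
      (λ {b} {d} πb≡a (lo≤d , d≤hi) →
        subst (λ i → a ℤ.+ π lo ℤ.≤ i ℤ.+ π d × i ℤ.+ π d ℤ.≤ a ℤ.+ π hi) (≡.sym πb≡a)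
              (ℤ.+-monoʳ-≤ a lo≤d , ℤ.+-monoʳ-≤ a d≤hi))
      fibre-levels lo≤D≤hi
    top-levels : All ((a ℤ.+ π hi ℤ.<_) ∘ π) (translate (above π a B) hi)
    top-levels = All-translate (ℤ.+-monoˡ-< (π hi)) (Allₚ.all-filter (λ x → a ℤ.<? π x) B)

  spreadAt⊆S : ∀ {B C S} → EnumeratesG H S (SumSet H B C) →
    ∀ {a lo hi D} → lo ∈ᴳ C → hi ∈ᴳ C → All (_∈ᴳ C) D → All (_∈ᴳ S) (spreadAt a lo hi D B)
  spreadAt⊆S {B} {C} {S} S≡B+C lo∈C hi∈C D⊆C =
    Allₚ.++⁺ (All-translate (λ b∈B → sum∈S b∈B lo∈C) (Allₚ.filter⁺ _ B⊆B))
      (Allₚ.++⁺ (All-sumsetList sum∈S (Allₚ.filter⁺ _ B⊆B) D⊆C)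
               (All-translate (λ b∈B → sum∈S b∈B hi∈C) (Allₚ.filter⁺ _ B⊆B)))
    where
    B⊆B = All-∈-self Gₛ B
    sum∈S : ∀ {b d} → b ∈ᴳ B → d ∈ᴳ C → (b ∙ d) ∈ᴳ S
    sum∈S {b} {d} b∈B d∈C = proj₂ (S≡B+C (b ∙ d)) (b , d , b∈B , d∈C , Gₛ.refl)

  sumset-fibre-bound : ∀ {B C S} → Uniqueᴳ B → EnumeratesG H S (SumSet H B C) →
    ∀ {d D} → All (_∈ᴳ C) (d ∷ D) → AllPairs (_≢_ on π) (d ∷ D) →
    ∀ a → length B + length D * length (fibre π a B) ≤ length S
  sumset-fibre-bound {B} {C} {S} B! S≡B+C {d} {D} D⊆C D! a = begin
    length B + length D * length (fibre π a B) ≡⟨ length-spreadAt a lo hi d D B ⟨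
    length (spreadAt a lo hi (d ∷ D) B)        ≤⟨ Unique∧⊆⇒length≤ Gₛ
                                                    (Unique-spreadAt B! lo≤hi lo≤D≤hi D!)
                                                    (spreadAt⊆S S≡B+C lo∈C hi∈C D⊆C) ⟩
    length S                                   ∎
    where
    open ≤-Reasoning
    open Data.List.Extrema ℤ.≤-totalOrder
      using (argmin; argmax; argmin-all; argmax-all; f[argmin]≤f[⊤]; f[argmin]≤f[xs]; f[⊥]≤f[argmax]; f[xs]≤f[argmax])
    lo = argmin π d D
    hi = argmax π d D
    lo∈C = argmin-all π (All.head D⊆C) (All.tail D⊆C)
    hi∈C = argmax-all π (All.head D⊆C) (All.tail D⊆C)
    lo≤D≤hi : All ((λ i → π lo ℤ.≤ i × i ℤ.≤ π hi) ∘ π) (d ∷ D)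
    lo≤D≤hi = All.zip ( f[argmin]≤f[⊤] {f = π} d D ∷ f[argmin]≤f[xs] {f = π} d D
                      , f[⊥]≤f[argmax] {f = π} d D ∷ f[xs]≤f[argmax] {f = π} d D )
    lo≤hi = ℤ.≤-trans (f[argmin]≤f[⊤] {f = π} d D) (f[⊥]≤f[argmax] {f = π} d D)

  fibres : List ℤ → List (G H) → List (G H)
  fibres M B = concatMap (λ a → fibre π a B) M

  fibres-cover : ∀ {M} B → EnumeratesImage H M B → All (_∈ᴳ fibres M B) B
  fibres-cover {M} B M≡πB = All.map b∈fibres (All-∈-self Gₛ B)
    where
    b∈fibres : ∀ {b} → b ∈ᴳ B → b ∈ᴳ fibres M B
    b∈fibres {b} b∈B = Anyₚ.concatMap⁺ (λ a → fibre π a B)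
      (Any.map (λ { refl → ∈-filter⁺ Gₛ (λ x → π x ℤ.≟ π b) (λ x≈y → ≡.trans (≡.sym (proj₁ x≈y))) b∈B refl })
               (proj₂ (M≡πB (π b)) (b , b∈B , refl)))

  representatives : ∀ {C N} → All (InImage H C) N → Σ (List (G H)) λ D → map π D ≡ N × All (_∈ᴳ C) D
  representatives []                      = [] , refl , []
  representatives ((d , d∈C , πd≡k) ∷ ks) with representatives ks
  ... | D , πD≡N , D⊆C = d ∷ D , ≡.cong₂ _∷_ πd≡k πD≡N , d∈C ∷ D⊆C

  nonempty-representatives : ∀ {C N} → C ≢ [] → EnumeratesImage H N C →
    Σ (G H) λ d → Σ (List (G H)) λ D → map π (d ∷ D) ≡ N × All (_∈ᴳ C) (d ∷ D)
  nonempty-representatives {[]}    C≢[] _ = contradiction refl C≢[]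
  nonempty-representatives {c ∷ C} _ N≡πC with representatives (All.tabulate (proj₁ (N≡πC _)))
  ... | d ∷ D , πD≡N , D⊆C = d , D , πD≡N , D⊆C
  ... | []    , refl , _ with proj₂ (N≡πC (π c)) (c , here Gₛ.refl , refl)
  ...   | ()

corollary3 : ∀ {c ℓ : Level} (H : AbelianGroup c ℓ) → FiniteGroup H →
    (B C : List (G H)) → DistinctG H B → DistinctG H C → B ≢ [] → C ≢ [] →
    (S : List (G H)) → DistinctG H S → EnumeratesG H S (SumSet H B C) →
    (M N : List ℤ) → Unique M → Unique N →
    EnumeratesImage H M B → EnumeratesImage H N C →
    (length M + length N ∸ 1) * length B ≤ length M * length S
corollary3 H _ B C B! _ _ C≢[] S _ S≡B+C M N _ N! M≡πB N≡πC
  with nonempty-representatives H C≢[] N≡πC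
... | d , D , πD≡N , D⊆C = begin
  (m + length N ∸ 1) * length B         ≡⟨ cong (λ n → (m + n ∸ 1) * length B) |N|≡1+k ⟨
  (m + suc k ∸ 1) * length B            ≡⟨ cong (λ n → (n ∸ 1) * length B) (+-suc m k) ⟩
  (m + k) * length B                    ≡⟨ *-distribʳ-+ (length B) m k ⟩
  m * length B + k * length B           ≤⟨ +-monoʳ-≤ (m * length B)
                                             (*-monoʳ-≤ k (Unique∧⊆⇒length≤ (AbelianGroup.setoid (ℤ⊕H H))
                                                            B! (fibres-cover H B M≡πB))) ⟩
  m * length B + k * length (fibres H M B) ≤⟨ concatMap-length-bound k (λ a → fibre (projℤ H) a B)
                                              (sumset-fibre-bound H B! S≡B+C D⊆C D!) M ⟩
  m * length S                          ∎
  where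
  open ≤-Reasoning
  m = length M
  k = length D
  |N|≡1+k : suc k ≡ length N
  |N|≡1+k = ≡.trans (≡.sym (length-map (projℤ H) (d ∷ D))) (cong length πD≡N)
  D! : AllPairs (_≢_ on projℤ H) (d ∷ D)
  D! = AllPairs.map⁻ (subst Unique (≡.sym πD≡N) N!)
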